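{- Let $\mathbf{f}$ be the Fibonacci word. If $k\ge2$ and $F_{k-1}\le n+1$, then $\operatorname{nsc}_{\mathbf{f}}(n)\ge F_{k-1}$.
   Context: The Fibonacci word is $\mathbf{f}=\phi^{\omega}(0)$, the fixed point of $\phi(0)=01$, $\phi(1)=0$. The Fibonacci sequence is $F_0=1$, $F_1=2$, $F_k=F_{k-1}+F_{k-2}$ for $k\ge2$. For an infinite word $\mathbf{x}=x_0x_1x_2\cdots$ (indexed from $0$) and $n\ge1$, $\operatorname{nsc}_{\mathbf{x}}(n)=\max\{m\in\mathbb{N}: x_i\cdots x_{i+n-1}\neq x_j\cdots x_{j+n-1}\text{ for all } 0\le i<j\le m-1\}$. -}

module Defs where

open import Data.Nat using (ℕ; zero; suc; _+_; _<_; _≤_)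
open import Data.List using (List; []; _∷_; _++_; map; upTo; concatMap)
open import Data.Product using (_×_)
open import Relation.Binary.PropositionalEquality using (_≡_)
open import Relation.Nullary using (¬_)

-- Fibonacci numbers with the paper's indexing: F 0 = 1, F 1 = 2, F k = F (k-1) + F (k-2).
F : ℕ → ℕ
F zero = 1
F (suc zero) = 2
F (suc (suc k)) = F (suc k) + F k

φ₁ : ℕ → List ℕ
φ₁ zero = 0 ∷ 1 ∷ []
φ₁ (suc _) = 0 ∷ []

φ : List ℕ → List ℕ
φ = concatMap φ₁

φpow : ℕ → List ℕ
φpow zero = 0 ∷ []
φpow (suc m) = φ (φpow m)

-- i-th letter of a finite word (default 0 out of range; never used below).
at : List ℕ → ℕ → ℕ
at [] _ = 0
at (a ∷ w) zero = a
at (a ∷ w) (suc i) = at w i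

-- The Fibonacci word f = φ^ω(0): each φ^m(0) is a prefix of φ^(m+1)(0),
-- and |φ^i(0)| = F i ≥ i + 1, so letter i of f is letter i of φ^i(0).
fib : ℕ → ℕ
fib i = at (φpow i) i

factor : (ℕ → ℕ) → ℕ → ℕ → List ℕ
factor x i n = map (λ t → x (i + t)) (upTo n)

DistinctPrefix : (ℕ → ℕ) → ℕ → ℕ → Set
DistinctPrefix x n m = ∀ i j → i < j → j < m → ¬ (factor x i n ≡ factor x j n)

IsNsc : (ℕ → ℕ) → ℕ → ℕ → Set
IsNsc x n m = DistinctPrefix x n m × (∀ m' → DistinctPrefix x n m' → m' ≤ m)

module Submission where

-- Write L = F(k-1) = F(r+1).  The prefix φ^(r+1)(0) of f has length L and
-- contains exactly F r zeros, a number coprime to L.  From the recursion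
-- φ^(M+2)(0) = φ^(M+1)(0) φ^M(0) one reads off f_(L+t) = f_t for t < L-1, so
-- f agrees on [0, 2L-1) with the L-periodic word c_x = f_(x mod L).  Two
-- equal factors of length n ≥ L-1 starting at i < j < L therefore give two
-- equal length-(L-1) windows of c at distance p = j-i, 0 < p < L.  The key
-- lemma (windows-distinct) rules this out: for an L-periodic sequence whose
-- sum over a period is coprime to L, equal windows of length L-1 extend by
-- counting to equal windows of length L, so the sequence is p-periodic, and
-- summing over L·p terms in two ways gives L ∣ p, impossible.  We apply it to
-- the zero indicator of c.  Finally nsc_f(n) exists as a maximum because
-- "the first m factors are distinct" is decidable and fails for m > F(n+1)
-- (f_0⋯f_(n-1) reoccurs at position F(n+1)).

open import Defs
open import Data.Nat using (ℕ; zero; suc; _+_; _*_; _∸_; _≤_; _<_; _≟_; z≤n; s≤s; NonZero; >-nonZero)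
open import Data.Nat.Properties
open import Data.Nat.DivMod using (_%_; _/_; m≡m%n+[m/n]*n; m%n<n; m<n⇒m%n≡m; [m+n]%n≡m%n)
open import Data.Nat.Divisibility using (_∣_; divides; >⇒∤)
open import Data.Nat.Coprimality using (Coprime; coprime-divisor; coprime-+; 1-coprimeTo) renaming (sym to coprime-sym)
open import Data.List using (List; []; _∷_; _++_; length; applyUpTo)
open import Data.List.Properties using (concatMap-++; length-++; ∷-injective; ≡-dec; map-upTo)
open import Data.Product using (_×_; _,_; ∃; proj₁; proj₂)
open import Data.Sum using (inj₁; inj₂)
open import Data.Empty using (⊥-elim)
open import Relation.Nullary using (¬_; Dec; yes; no; ¬?)
open import Relation.Nullary.Decidable using (map′)
open import Relation.Binary.PropositionalEquality
open import Algebra.Properties.CommutativeSemigroup +-commutativeSemigroup using (xy∙z≈xz∙y)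

φ-++ : ∀ u v → φ (u ++ v) ≡ φ u ++ φ v
φ-++ = concatMap-++ φ₁

φpow-rec : ∀ M → φpow (suc (suc M)) ≡ φpow (suc M) ++ φpow M
φpow-rec zero = refl
φpow-rec (suc M) = trans (cong φ (φpow-rec M)) (φ-++ (φpow (suc M)) (φpow M))

length-φpow : ∀ M → length (φpow M) ≡ F M
length-φpow zero = refl
length-φpow (suc zero) = refl
length-φpow (suc (suc M)) = begin
  length (φpow (suc (suc M)))             ≡⟨ cong length (φpow-rec M) ⟩
  length (φpow (suc M) ++ φpow M)         ≡⟨ length-++ (φpow (suc M)) ⟩
  length (φpow (suc M)) + length (φpow M) ≡⟨ cong₂ _+_ (length-φpow (suc M)) (length-φpow M) ⟩
  F (suc (suc M))                         ∎
  where open ≡-Reasoning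

F-≤-suc : ∀ M → F M ≤ F (suc M)
F-≤-suc zero = s≤s z≤n
F-≤-suc (suc M) = m≤m+n (F (suc M)) (F M)

F-mono : ∀ d M → F M ≤ F (d + M)
F-mono zero M = ≤-refl
F-mono (suc d) M = ≤-trans (F-mono d M) (F-≤-suc (d + M))

n<F : ∀ n → n < F n
n<F zero = s≤s z≤n
n<F (suc zero) = s≤s (s≤s z≤n)
n<F (suc (suc n)) = begin-strict
  suc (suc n)            <⟨ s≤s (n<F (suc n)) ⟩
  suc (F (suc n))        ≡⟨ +-comm 1 (F (suc n)) ⟩
  F (suc n) + 1          ≤⟨ +-monoʳ-≤ (F (suc n)) (≤-trans (s≤s z≤n) (n<F n)) ⟩
  F (suc n) + F n        ∎
  where open ≤-Reasoning

F-coprime : ∀ M → Coprime (F (suc M)) (F M)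
F-coprime zero = coprime-sym (1-coprimeTo 2)
F-coprime (suc M) = coprime-+ (coprime-sym (F-coprime M))

at-++ˡ : ∀ u v t → t < length u → at (u ++ v) t ≡ at u t
at-++ˡ (a ∷ u) v zero _ = refl
at-++ˡ (a ∷ u) v (suc t) (s≤s t<) = at-++ˡ u v t t<

at-++ʳ : ∀ u v t → at (u ++ v) (length u + t) ≡ at v t
at-++ʳ [] v t = refl
at-++ʳ (a ∷ u) v t = at-++ʳ u v t

φpow-prefix-suc : ∀ M t → t < F M → at (φpow (suc M)) t ≡ at (φpow M) t
φpow-prefix-suc zero zero _ = refl
φpow-prefix-suc zero (suc t) (s≤s ())
φpow-prefix-suc (suc M) t t< = trans (cong (λ w → at w t) (φpow-rec M))
  (at-++ˡ (φpow (suc M)) (φpow M) t (subst (t <_) (sym (length-φpow (suc M))) t<))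

φpow-prefix : ∀ d M t → t < F M → at (φpow (d + M)) t ≡ at (φpow M) t
φpow-prefix zero M t t< = refl
φpow-prefix (suc d) M t t< =
  trans (φpow-prefix-suc (d + M) t (≤-trans t< (F-mono d M))) (φpow-prefix d M t t<)

fib-at : ∀ M t → t < F M → fib t ≡ at (φpow M) t
fib-at M t t< with ≤-total t M
... | inj₁ t≤M = trans (sym (φpow-prefix (M ∸ t) t t (n<F t)))
                       (cong (λ K → at (φpow K) t) (m∸n+n≡m t≤M))
... | inj₂ M≤t = trans (cong (λ K → at (φpow K) t) (sym (m∸n+n≡m M≤t)))
                       (φpow-prefix (t ∸ M) M t t<)

-- Reading φ^(M+2)(0) = φ^(M+1)(0) φ^M(0): after position F(M+1), f repeats
-- its first F M letters.
fib-shift : ∀ M t → t < F M → fib (F (suc M) + t) ≡ fib t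
fib-shift M t t< = begin
  fib (F (suc M) + t)                                     ≡⟨ fib-at (suc (suc M)) _ (+-monoʳ-< (F (suc M)) t<) ⟩
  at (φpow (suc (suc M))) (F (suc M) + t)                 ≡⟨ cong (λ w → at w (F (suc M) + t)) (φpow-rec M) ⟩
  at (φpow (suc M) ++ φpow M) (F (suc M) + t)             ≡⟨ cong (λ K → at (φpow (suc M) ++ φpow M) (K + t)) (sym (length-φpow (suc M))) ⟩
  at (φpow (suc M) ++ φpow M) (length (φpow (suc M)) + t) ≡⟨ at-++ʳ (φpow (suc M)) (φpow M) t ⟩
  at (φpow M) t                                           ≡⟨ sym (fib-at M t t<) ⟩
  fib t                                                   ∎
  where open ≡-Reasoning

-- With L = F(r+1), the prefix of f of length 2L-1 has period L: apply
-- fib-shift once, or (past F r) twice, using F(r+3) = F(r+2) + F(r+1).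
fib-square : ∀ r t → suc t < F (suc r) → fib (F (suc r) + t) ≡ fib t
fib-square zero zero _ = refl
fib-square zero (suc t) (s≤s (s≤s ()))
fib-square (suc r) t st< with t <? F (suc r)
... | yes t< = fib-shift (suc r) t t<
... | no t≮ = begin
  fib (F (suc (suc r)) + t)                 ≡⟨ cong (λ s → fib (F (suc (suc r)) + s)) (sym t≡) ⟩
  fib (F (suc (suc r)) + (F (suc r) + u))   ≡⟨ cong fib (sym (+-assoc (F (suc (suc r))) (F (suc r)) u)) ⟩
  fib (F (suc (suc (suc r))) + u)           ≡⟨ fib-shift (suc (suc r)) u (≤-trans u< (F-mono 2 r)) ⟩
  fib u                                     ≡⟨ sym (fib-shift r u u<) ⟩
  fib (F (suc r) + u)                       ≡⟨ cong fib t≡ ⟩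
  fib t                                     ∎
  where
  open ≡-Reasoning
  u : ℕ
  u = t ∸ F (suc r)
  t≡ : F (suc r) + u ≡ t
  t≡ = m+[n∸m]≡n (≮⇒≥ t≮)
  u< : u < F r
  u< = +-cancelˡ-< (F (suc r)) u (F r) (subst (_< F (suc r) + F r) (sym t≡) (<-trans (n<1+n t) st<))

sumBelow : (ℕ → ℕ) → ℕ → ℕ
sumBelow g zero = 0
sumBelow g (suc n) = sumBelow g n + g n

sumBelow-cong : ∀ g g' n → (∀ t → t < n → g t ≡ g' t) → sumBelow g n ≡ sumBelow g' n
sumBelow-cong g g' zero eq = refl
sumBelow-cong g g' (suc n) eq =
  cong₂ _+_ (sumBelow-cong g g' n (λ t t< → eq t (m<n⇒m<1+n t<))) (eq n ≤-refl)

sumBelow-first : ∀ g n → sumBelow g (suc n) ≡ g 0 + sumBelow (λ t → g (suc t)) n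
sumBelow-first g zero = +-comm 0 (g 0)
sumBelow-first g (suc n) = trans (cong (_+ g (suc n)) (sumBelow-first g n)) (+-assoc (g 0) _ _)

sumBelow-+ : ∀ g a b → sumBelow g (a + b) ≡ sumBelow g a + sumBelow (λ t → g (a + t)) b
sumBelow-+ g a zero = trans (cong (sumBelow g) (+-identityʳ a)) (sym (+-identityʳ _))
sumBelow-+ g a (suc b) = begin
  sumBelow g (a + suc b)                                  ≡⟨ cong (sumBelow g) (+-suc a b) ⟩
  sumBelow g (a + b) + g (a + b)                          ≡⟨ cong (_+ g (a + b)) (sumBelow-+ g a b) ⟩
  sumBelow g a + sumBelow (λ t → g (a + t)) b + g (a + b) ≡⟨ +-assoc (sumBelow g a) _ _ ⟩
  sumBelow g a + sumBelow (λ t → g (a + t)) (suc b)       ∎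
  where open ≡-Reasoning

Periodic : (ℕ → ℕ) → ℕ → Set
Periodic h p = ∀ x → h (x + p) ≡ h x

periodic-* : ∀ h p → Periodic h p → ∀ c y → h (y + c * p) ≡ h y
periodic-* h p per zero y = cong h (+-identityʳ y)
periodic-* h p per (suc c) y = begin
  h (y + (p + c * p)) ≡⟨ cong h (sym (+-assoc y p (c * p))) ⟩
  h (y + p + c * p)   ≡⟨ periodic-* h p per c (y + p) ⟩
  h (y + p)           ≡⟨ per y ⟩
  h y                 ∎
  where open ≡-Reasoning

sumBelow-periods : ∀ h p → Periodic h p → ∀ c → sumBelow h (c * p) ≡ c * sumBelow h p
sumBelow-periods h p per zero = refl
sumBelow-periods h p per (suc c) = begin
  sumBelow h (p + c * p)                                ≡⟨ sumBelow-+ h p (c * p) ⟩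
  sumBelow h p + sumBelow (λ t → h (p + t)) (c * p)     ≡⟨ cong (sumBelow h p +_) (sumBelow-cong _ h (c * p) (λ t _ → trans (cong h (+-comm p t)) (per t))) ⟩
  sumBelow h p + sumBelow h (c * p)                     ≡⟨ cong (sumBelow h p +_) (sumBelow-periods h p per c) ⟩
  sumBelow h p + c * sumBelow h p                       ∎
  where open ≡-Reasoning

window : (ℕ → ℕ) → ℕ → ℕ → ℕ
window h x n = sumBelow (λ t → h (x + t)) n

window-periodic : ∀ h L → Periodic h L → ∀ x → window h x L ≡ sumBelow h L
window-periodic h L per zero = refl
window-periodic h L per (suc x) = trans slide (window-periodic h L per x)
  where
  open ≡-Reasoning
  slide : window h (suc x) L ≡ window h x L
  slide = +-cancelˡ-≡ (h x) _ _ (begin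
    h x + window h (suc x) L                               ≡⟨ cong₂ _+_ (cong h (sym (+-identityʳ x))) (sumBelow-cong _ _ L (λ t _ → cong h (sym (+-suc x t)))) ⟩
    h (x + 0) + sumBelow (λ t → h (x + suc t)) L           ≡⟨ sym (sumBelow-first (λ t → h (x + t)) L) ⟩
    window h x (suc L)                                     ≡⟨ cong (window h x L +_) (per x) ⟩
    window h x L + h x                                     ≡⟨ +-comm (window h x L) (h x) ⟩
    h x + window h x L                                     ∎)

-- Counting argument: for an (ℓ+1)-periodic sequence, two windows agreeing on
-- their first ℓ terms have equal sums, so they also agree on the last term.
windows-agree : ∀ h ℓ → Periodic h (suc ℓ) → ∀ i j →
  (∀ t → t < ℓ → h (i + t) ≡ h (j + t)) → ∀ t → t < suc ℓ → h (i + t) ≡ h (j + t)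
windows-agree h ℓ per i j agree t (s≤s t≤ℓ) with m≤n⇒m<n∨m≡n t≤ℓ
... | inj₁ t<ℓ = agree t t<ℓ
... | inj₂ refl = +-cancelˡ-≡ (window h i ℓ) _ _ (begin
  window h i ℓ + h (i + ℓ)  ≡⟨ window-periodic h (suc ℓ) per i ⟩
  sumBelow h (suc ℓ)        ≡⟨ sym (window-periodic h (suc ℓ) per j) ⟩
  window h j ℓ + h (j + ℓ)  ≡⟨ cong (_+ h (j + ℓ)) (sumBelow-cong _ _ ℓ (λ t t< → sym (agree t t<))) ⟩
  window h i ℓ + h (j + ℓ)  ∎)
  where open ≡-Reasoning

local-period : ∀ h L .{{_ : NonZero L}} → Periodic h L → ∀ i p →
  (∀ t → t < L → h (i + t + p) ≡ h (i + t)) → Periodic h p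
local-period h L per i p local y = begin
  h (y + p)                 ≡⟨ sym (periodic-* h L per i (y + p)) ⟩
  h (y + p + i * L)         ≡⟨ cong h (xy∙z≈xz∙y y p (i * L)) ⟩
  h (y + i * L + p)         ≡⟨ cong (λ w → h (w + p)) y′≡ ⟩
  h (i + s + q * L + p)     ≡⟨ cong h (xy∙z≈xz∙y (i + s) (q * L) p) ⟩
  h (i + s + p + q * L)     ≡⟨ periodic-* h L per q (i + s + p) ⟩
  h (i + s + p)             ≡⟨ local s (m%n<n d L) ⟩
  h (i + s)                 ≡⟨ sym (periodic-* h L per q (i + s)) ⟩
  h (i + s + q * L)         ≡⟨ cong h (sym y′≡) ⟩
  h (y + i * L)             ≡⟨ periodic-* h L per i y ⟩
  h y                       ∎
  where
  open ≡-Reasoning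
  -- Shift y forward to y′ ≥ i and write y′ = i + s + q·L with s < L.
  d s q : ℕ
  d = y + i * L ∸ i
  s = d % L
  q = d / L
  y′≡ : y + i * L ≡ i + s + q * L
  y′≡ = begin
    y + i * L              ≡⟨ sym (m+[n∸m]≡n (≤-trans (m≤m*n i L) (m≤n+m (i * L) y))) ⟩
    i + d                  ≡⟨ cong (i +_) (m≡m%n+[m/n]*n d L) ⟩
    i + (s + q * L)        ≡⟨ sym (+-assoc i s (q * L)) ⟩
    i + s + q * L          ∎

-- Two periods L and p, where the sum over an L-period is coprime to L,
-- force L ∣ p: summing over L·p terms gives p·(Σ_L h) = L·(Σ_p h).
coprime-period-divides : ∀ h L p → Periodic h L → Periodic h p →
  Coprime L (sumBelow h L) → L ∣ p
coprime-period-divides h L p perL perp cop = coprime-divisor cop (divides (sumBelow h p) (begin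
  sumBelow h L * p     ≡⟨ *-comm (sumBelow h L) p ⟩
  p * sumBelow h L     ≡⟨ sym (sumBelow-periods h L perL p) ⟩
  sumBelow h (p * L)   ≡⟨ cong (sumBelow h) (*-comm p L) ⟩
  sumBelow h (L * p)   ≡⟨ sumBelow-periods h p perp L ⟩
  L * sumBelow h p     ≡⟨ *-comm L (sumBelow h p) ⟩
  sumBelow h p * L     ∎))
  where open ≡-Reasoning

windows-distinct : ∀ h L → Periodic h L → Coprime L (sumBelow h L) →
  ∀ i p → 0 < p → p < L → ¬ (∀ t → suc t < L → h (i + t) ≡ h (i + p + t))
windows-distinct h L@(suc ℓ) per cop i p@(suc _) _ p<L agree =
  >⇒∤ p<L (coprime-period-divides h L p per p-period cop)
  where
  agree-full : ∀ t → t < L → h (i + t) ≡ h (i + p + t)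
  agree-full = windows-agree h ℓ per i (i + p) (λ t t< → agree t (s≤s t<))
  p-period : Periodic h p
  p-period = local-period h L per i p (λ t t< →
    trans (cong h (xy∙z≈xz∙y i t p)) (sym (agree-full t t<)))

isZero : ℕ → ℕ
isZero zero = 1
isZero (suc _) = 0

zeroCount : List ℕ → ℕ
zeroCount [] = 0
zeroCount (a ∷ w) = isZero a + zeroCount w

zeroCount-++ : ∀ u v → zeroCount (u ++ v) ≡ zeroCount u + zeroCount v
zeroCount-++ [] v = refl
zeroCount-++ (a ∷ u) v = trans (cong (isZero a +_) (zeroCount-++ u v)) (sym (+-assoc (isZero a) _ _))

zeroCount-φpow : ∀ M → zeroCount (φpow (suc M)) ≡ F M
zeroCount-φpow zero = refl
zeroCount-φpow (suc zero) = refl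
zeroCount-φpow (suc (suc M)) = begin
  zeroCount (φpow (suc (suc (suc M))))                             ≡⟨ cong zeroCount (φpow-rec (suc M)) ⟩
  zeroCount (φpow (suc (suc M)) ++ φpow (suc M))                   ≡⟨ zeroCount-++ (φpow (suc (suc M))) (φpow (suc M)) ⟩
  zeroCount (φpow (suc (suc M))) + zeroCount (φpow (suc M))        ≡⟨ cong₂ _+_ (zeroCount-φpow (suc M)) (zeroCount-φpow M) ⟩
  F (suc (suc M))                                                  ∎
  where open ≡-Reasoning

zeroCount-sumBelow : ∀ w → zeroCount w ≡ sumBelow (λ t → isZero (at w t)) (length w)
zeroCount-sumBelow [] = refl
zeroCount-sumBelow (a ∷ w) = trans (cong (isZero a +_) (zeroCount-sumBelow w))
  (sym (sumBelow-first (λ t → isZero (at (a ∷ w) t)) (length w)))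

applyUpTo-≡⇒pointwise : ∀ {A : Set} (f g : ℕ → A) n → applyUpTo f n ≡ applyUpTo g n →
  ∀ t → t < n → f t ≡ g t
applyUpTo-≡⇒pointwise f g (suc n) eq zero _ = proj₁ (∷-injective eq)
applyUpTo-≡⇒pointwise f g (suc n) eq (suc t) (s≤s t<) =
  applyUpTo-≡⇒pointwise (λ s → f (suc s)) (λ s → g (suc s)) n (proj₂ (∷-injective eq)) t t<

pointwise⇒applyUpTo-≡ : ∀ {A : Set} (f g : ℕ → A) n → (∀ t → t < n → f t ≡ g t) →
  applyUpTo f n ≡ applyUpTo g n
pointwise⇒applyUpTo-≡ f g zero eq = refl
pointwise⇒applyUpTo-≡ f g (suc n) eq = cong₂ _∷_ (eq 0 (s≤s z≤n))
  (pointwise⇒applyUpTo-≡ (λ s → f (suc s)) (λ s → g (suc s)) n (λ t t< → eq (suc t) (s≤s t<)))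

factor-≡⇒pointwise : ∀ x i j n → factor x i n ≡ factor x j n →
  ∀ t → t < n → x (i + t) ≡ x (j + t)
factor-≡⇒pointwise x i j n eq = applyUpTo-≡⇒pointwise _ _ n
  (trans (sym (map-upTo (λ t → x (i + t)) n)) (trans eq (map-upTo (λ t → x (j + t)) n)))

pointwise⇒factor-≡ : ∀ x i j n → (∀ t → t < n → x (i + t) ≡ x (j + t)) →
  factor x i n ≡ factor x j n
pointwise⇒factor-≡ x i j n eq = trans (map-upTo (λ t → x (i + t)) n)
  (trans (pointwise⇒applyUpTo-≡ _ _ n eq) (sym (map-upTo (λ t → x (j + t)) n)))

-- The cyclic Fibonacci word of period L = F(r+1), x ↦ f_(x mod L), and the
-- lower bound it yields.
module CyclicFibonacci (r : ℕ) where

  L : ℕ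
  L = F (suc r)

  instance
    L-nonZero : NonZero L
    L-nonZero = >-nonZero (≤-trans (s≤s z≤n) (n<F (suc r)))

  zeros : ℕ → ℕ
  zeros x = isZero (fib (x % L))

  zeros-periodic : Periodic zeros L
  zeros-periodic x = cong (λ y → isZero (fib y)) ([m+n]%n≡m%n x L)

  cyclic-fib : ∀ y → suc y < L + L → fib (y % L) ≡ fib y
  cyclic-fib y sy< with y <? L
  ... | yes y<L = cong fib (m<n⇒m%n≡m y<L)
  ... | no y≮L = begin
    fib (y % L)             ≡⟨ cong (λ w → fib (w % L)) (sym y≡) ⟩
    fib ((L + u) % L)       ≡⟨ cong (λ w → fib (w % L)) (+-comm L u) ⟩
    fib ((u + L) % L)       ≡⟨ cong fib ([m+n]%n≡m%n u L) ⟩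
    fib (u % L)             ≡⟨ cong fib (m<n⇒m%n≡m (<-trans (n<1+n u) su<L)) ⟩
    fib u                   ≡⟨ sym (fib-square r u su<L) ⟩
    fib (L + u)             ≡⟨ cong fib y≡ ⟩
    fib y                   ∎
    where
    open ≡-Reasoning
    u : ℕ
    u = y ∸ L
    y≡ : L + u ≡ y
    y≡ = m+[n∸m]≡n (≮⇒≥ y≮L)
    su<L : suc u < L
    su<L = +-cancelˡ-< L (suc u) L (subst (_< L + L) (trans (cong suc (sym y≡)) (sym (+-suc L u))) sy<)

  -- Over one period the cyclic word has F r zeros, a number coprime to L.
  zeros-coprime : Coprime L (sumBelow zeros L)
  zeros-coprime = subst (Coprime L) (sym zeros-sum) (F-coprime r)
    where
    open ≡-Reasoning
    w : List ℕ
    w = φpow (suc r)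
    zeros-sum : sumBelow zeros L ≡ F r
    zeros-sum = begin
      sumBelow zeros L                                  ≡⟨ sumBelow-cong _ _ _ (λ t t< → cong isZero (trans (cong fib (m<n⇒m%n≡m t<)) (fib-at (suc r) t t<))) ⟩
      sumBelow (λ t → isZero (at w t)) L                ≡⟨ cong (sumBelow _) (sym (length-φpow (suc r))) ⟩
      sumBelow (λ t → isZero (at w t)) (length w)       ≡⟨ sym (zeroCount-sumBelow w) ⟩
      zeroCount w                                       ≡⟨ zeroCount-φpow r ⟩
      F r                                               ∎

  -- For L ≤ n + 1 the first L factors of f of length n are pairwise distinct:
  -- equal factors at i < j < L would be equal length-(L-1) windows of the
  -- cyclic word, contradicting the key lemma.
  lower-bound : ∀ n → L ≤ n + 1 → DistinctPrefix fib n L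
  lower-bound n bound i j i<j j<L eq =
    windows-distinct zeros L zeros-periodic zeros-coprime i (j ∸ i)
      (m<n⇒0<n∸m i<j) (≤-<-trans (m∸n≤m j i) j<L) agree
    where
    -- Positions a + t with a < L and t + 1 < L lie in [0, 2L-1).
    zeros≡fib : ∀ a t → a < L → suc t < L → zeros (a + t) ≡ isZero (fib (a + t))
    zeros≡fib a t a< st< = cong isZero (cyclic-fib (a + t)
      (subst (_< L + L) (+-suc a t) (+-mono-< a< st<)))
    agree : ∀ t → suc t < L → zeros (i + t) ≡ zeros (i + (j ∸ i) + t)
    agree t st< = begin
      zeros (i + t)               ≡⟨ zeros≡fib i t (<-trans i<j j<L) st< ⟩
      isZero (fib (i + t))        ≡⟨ cong isZero (factor-≡⇒pointwise fib i j n eq t t<n) ⟩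
      isZero (fib (j + t))        ≡⟨ sym (zeros≡fib j t j<L st<) ⟩
      zeros (j + t)               ≡⟨ cong (λ w → zeros (w + t)) (sym (m+[n∸m]≡n (<⇒≤ i<j))) ⟩
      zeros (i + (j ∸ i) + t)     ∎
      where
      open ≡-Reasoning
      t<n : t < n
      t<n = ≤-pred (≤-trans st< (subst (L ≤_) (+-comm n 1) bound))

-- Upper bound: f_0⋯f_(n-1) reoccurs at position F(n+1), so at most F(n+1)
-- of the first factors can be pairwise distinct.
upper-bound : ∀ n m → DistinctPrefix fib n m → m ≤ F (suc n)
upper-bound n m distinct with m ≤? F (suc n)
... | yes m≤ = m≤
... | no m≰ = ⊥-elim (distinct 0 (F (suc n)) (≤-trans (s≤s z≤n) (n<F (suc n))) (≰⇒> m≰)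
  (pointwise⇒factor-≡ fib 0 (F (suc n)) n (λ t t< → sym (fib-shift n t (<-trans t< (n<F n))))))

DistinctPrefix-dec : ∀ x n m → Dec (DistinctPrefix x n m)
DistinctPrefix-dec x n m = map′
  (λ all i j i<j j<m → all j<m i<j)
  (λ distinct {j} j<m {i} i<j → distinct i j i<j j<m)
  (allUpTo? (λ j → allUpTo? (λ i → ¬? (≡-dec _≟_ (factor x i n) (factor x j n))) j) m)

bounded-maximum : (P : ℕ → Set) → (∀ m → Dec (P m)) → ∀ b → (∀ m → P m → m ≤ b) →
  ∀ m₀ → P m₀ → ∃ λ m → P m × (∀ m′ → P m′ → m′ ≤ m)
bounded-maximum P P? b bounded m₀ Pm₀ with P? b
... | yes Pb = b , Pb , bounded
bounded-maximum P P? zero bounded m₀ Pm₀ | no ¬Pb =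
  ⊥-elim (¬Pb (subst P (n≤0⇒n≡0 (bounded m₀ Pm₀)) Pm₀))
bounded-maximum P P? (suc b) bounded m₀ Pm₀ | no ¬Pb = bounded-maximum P P? b bounded′ m₀ Pm₀
  where
  bounded′ : ∀ m → P m → m ≤ b
  bounded′ m Pm with m≤n⇒m<n∨m≡n (bounded m Pm)
  ... | inj₁ m<1+b = ≤-pred m<1+b
  ... | inj₂ refl = ⊥-elim (¬Pb Pm)

nsc-at-least : ∀ n ℓ → DistinctPrefix fib n ℓ → ∃ λ m → IsNsc fib n m × ℓ ≤ m
nsc-at-least n ℓ ℓ-distinct
  with bounded-maximum (DistinctPrefix fib n) (DistinctPrefix-dec fib n)
         (F (suc n)) (upper-bound n) ℓ ℓ-distinct
... | m , distinct , maximal = m , (distinct , maximal) , maximal ℓ ℓ-distinct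

mainTheorem10 : (k n : ℕ) → 2 ≤ k → 1 ≤ n → F (k ∸ 1) ≤ n + 1 →
    ∃ λ m → IsNsc fib n m × F (k ∸ 1) ≤ m
mainTheorem10 (suc (suc r)) n _ _ bound =
  nsc-at-least n (F (suc r)) (CyclicFibonacci.lower-bound r n bound)
mainTheorem10 (suc zero) n (s≤s ()) _ _
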